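{- Let $q$ be a prime power, $V=\mathbb{F}_q^v$, and let $l,m,M$ be integers with $l<2m$. For $m\le i\le M$ let $A_i$ be a set of $i$-dimensional subspaces of $V$, such that $d_S(U,W)\ge \dim(U)+\dim(W)-l$ for all distinct $U,W\in\bigcup_{i=m}^{M}A_i$. Then \[\#\bigcup_{i=m}^{M}A_i\le A_q(v,2m-l;m).\]
   Context: The subspace distance is $d_S(U,W)=\dim(U+W)-\dim(U\cap W)$. $A_q(v,d;k)$ denotes the maximum cardinality of a set of $k$-dimensional subspaces of $\mathbb{F}_q^v$ in which any two distinct elements have subspace distance at least $d$. -}

module Defs where

open import Level using (0ℓ)
open import Data.Nat using (ℕ; zero; suc; _≤_)
open import Data.Integer as ℤ using (ℤ; +_)
open import Data.Fin using (Fin)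
open import Data.Vec using (Vec; []; _∷_; zipWith; map; replicate)
open import Data.Product using (Σ; _×_; _,_; ∃)
open import Relation.Nullary using (¬_)
open import Relation.Binary.PropositionalEquality using (_≡_)
open import Relation.Binary.Definitions using (DecidableEquality)
open import Algebra.Structures using (IsCommutativeRing)
open import Function.Bundles using (_↔_; _⇔_)

-- A finite field with exactly q elements (equality is propositional).
-- Such a field exists iff q is a prime power, and it is unique up to
-- isomorphism, so this is F_q.
record FiniteField (q : ℕ) : Set₁ where
  field
    Carrier : Set
    _+_ _*_ : Carrier → Carrier → Carrier
    -_ : Carrier → Carrier
    0# 1# : Carrier
    isCommutativeRing : IsCommutativeRing _≡_ _+_ _*_ -_ 0# 1#
    0≢1 : ¬ (0# ≡ 1#)
    inverse : ∀ x → ¬ (x ≡ 0#) → Σ Carrier (λ y → x * y ≡ 1#)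
    _≟_ : DecidableEquality Carrier
    card : Fin q ↔ Carrier

module _ {q : ℕ} (𝔽 : FiniteField q) where
  open FiniteField 𝔽

  Vect : ℕ → Set
  Vect v = Vec Carrier v

  zeroV : ∀ {v} → Vect v
  zeroV = replicate _ 0#

  _⊕_ : ∀ {v} → Vect v → Vect v → Vect v
  _⊕_ = zipWith _+_

  _⊙_ : ∀ {v} → Carrier → Vect v → Vect v
  c ⊙ x = map (c *_) x

  lincomb : ∀ {v k} → Vec Carrier k → Vec (Vect v) k → Vect v
  lincomb [] [] = zeroV
  lincomb (c ∷ cs) (b ∷ bs) = (c ⊙ b) ⊕ lincomb cs bs

  record Subspace (v : ℕ) : Set₁ where
    field
      mem : Vect v → Set
      mem-0 : mem zeroV
      mem-+ : ∀ {x y} → mem x → mem y → mem (x ⊕ y)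
      mem-· : ∀ c {x} → mem x → mem (c ⊙ x)
  open Subspace public

  _≐_ : ∀ {v} → Subspace v → Subspace v → Set
  U ≐ W = ∀ x → (mem U x ⇔ mem W x)

  LinIndep : ∀ {v k} → Vec (Vect v) k → Set
  LinIndep {k = k} bs = ∀ (cs : Vec Carrier k) → lincomb cs bs ≡ zeroV → cs ≡ replicate k 0#

  HasDimSet : ∀ {v} → (Vect v → Set) → ℕ → Set
  HasDimSet {v} P k = Σ (Vec (Vect v) k) λ bs →
    LinIndep bs × (∀ x → (P x ⇔ Σ (Vec Carrier k) λ cs → lincomb cs bs ≡ x))

  HasDim : ∀ {v} → Subspace v → ℕ → Set
  HasDim U k = HasDimSet (mem U) k

  sumSet : ∀ {v} → Subspace v → Subspace v → Vect v → Set
  sumSet U W x = Σ _ λ u → Σ _ λ w → mem U u × mem W w × (u ⊕ w ≡ x)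

  capSet : ∀ {v} → Subspace v → Subspace v → Vect v → Set
  capSet U W x = mem U x × mem W x

  -- d_S(U,W) ≥ d, where d_S(U,W) = dim(U+W) - dim(U∩W)
  DistGE : ∀ {v} → Subspace v → Subspace v → ℤ → Set
  DistGE U W d = ∀ a b → HasDimSet (sumSet U W) a → HasDimSet (capSet U W) b →
    d ℤ.≤ (+ a) ℤ.- (+ b)

  IsCode : (v : ℕ) → ℤ → ℕ → (N : ℕ) → (Fin N → Subspace v) → Set
  IsCode v d k N C =
    (∀ j → HasDim (C j) k) ×
    (∀ j j' → ¬ (j ≡ j') → ¬ (C j ≐ C j')) ×
    (∀ j j' → ¬ (j ≡ j') → DistGE (C j) (C j') d)

  IsAq : (v : ℕ) → ℤ → ℕ → ℕ → Set₁
  IsAq v d k a =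
    (Σ (Fin a → Subspace v) λ C → IsCode v d k a C) ×
    (∀ N (C : Fin N → Subspace v) → IsCode v d k N C → N ≤ a)

module Submission where

open import Defs
open import Data.Nat using (ℕ; _≤_)
open import Data.Integer as ℤ using (ℤ; +_)
open import Data.Fin using (Fin)
open import Data.Product using (_×_)
open import Relation.Nullary using (¬_)
open import Relation.Binary.PropositionalEquality using (_≡_)

open import Level using (0ℓ)
open import Data.Nat as ℕ using (zero; suc; _^_; _<_; s≤s⁻¹)
open import Data.Nat.Properties using (≤-antisym; <⇒≱; ≮⇒≥; ^-monoʳ-<; m≤n+m; m≤n⇒m<n∨m≡n)
import Data.Nat.Properties as ℕ
open import Data.Nat.Solver using (module +-*-Solver)
open import Data.Integer.Properties as ℤ
  using (pos-+; +-monoʳ-≤; neg-mono-≤; neg-cancel-≤; *-monoˡ-≤-nonNeg)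
import Data.Integer.Solver as ℤ-Solver
open import Data.Fin.Properties using (*↔×; injective⇒≤; any?)
open import Data.Vec using (Vec; []; _∷_; _++_; map; replicate; splitAt)
open import Data.Vec.Properties
  using ( ≡-dec; ++-injective; map-cong; map-∘; map-id; map-const; map-replicate
        ; zipWith-assoc; zipWith-comm; zipWith-identityˡ; zipWith-identityʳ
        ; zipWith-inverseˡ; zipWith-inverseʳ)
open import Data.Product as Σ using (Σ; ∃; _,_; proj₁; proj₂; uncurry)
open import Data.Product.Function.NonDependent.Propositional using (_×-↔_)
open import Data.Sum using (inj₁; inj₂)
open import Data.Empty using (⊥-elim)
open import Function using (id; _∘_)
open import Function.Bundles using (_↔_; _⇔_; mk⇔; mk↔ₛ′; Inverse; Equivalence; Injection; mk↣)
open import Function.Definitions using (Injective)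
open import Function.Properties.Inverse using (↔-sym; ↔-trans; ↔⇒↣)
open import Function.Construct.Symmetry using (⇔-sym)
open import Function.Construct.Composition using (_↣-∘_)
open import Algebra.Bundles using (AbelianGroup)
open import Algebra.Structures using (IsCommutativeRing)
import Algebra.Properties.AbelianGroup as AbelianGroupProperties
import Algebra.Properties.CommutativeSemigroup as CommutativeSemigroupProperties
open import Relation.Nullary using (Dec; yes; no)
open import Relation.Nullary.Decidable using (map′; decidable-stable; _×-dec_; ¬?)
import Relation.Nullary.Decidable as Dec
open import Relation.Unary using (Pred; _⊆_; Decidable)
open import Relation.Binary.PropositionalEquality
  using (refl; sym; trans; cong; cong₂; subst; subst₂; module ≡-Reasoning)
open import Relation.Binary.PropositionalEquality.Algebra using (isMagma)

-- Replace each S_j by an m-dimensional subspace T_j ⊆ S_j. By the Grassmann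
-- formula d_S(U,W) = dim U + dim W − 2·dim(U ∩ W), so the hypothesis on S_j, S_j'
-- says exactly that 2·dim(S_j ∩ S_j') ≤ l. This bound passes to the smaller
-- intersection T_j ∩ T_j', and for the m-dimensional T_j it says
-- d_S(T_j,T_j') ≥ 2m − l > 0. So the T_j are pairwise distinct and form a code
-- of size N.

Fin^↔Vec : ∀ {A : Set} {q} → Fin q ↔ A → ∀ k → Fin (q ^ k) ↔ Vec A k
Fin^↔Vec Fin↔A zero =
  mk↔ₛ′ (λ _ → []) (λ _ → Fin.zero) (λ { [] → refl }) (λ { Fin.zero → refl ; (Fin.suc ()) })
Fin^↔Vec Fin↔A (suc k) =
  ↔-trans *↔× (↔-trans (Fin↔A ×-↔ Fin^↔Vec Fin↔A k) uncons↔)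
  where
  uncons↔ : ∀ {A : Set} {n} → (A × Vec A n) ↔ Vec A (suc n)
  uncons↔ = mk↔ₛ′ (uncurry _∷_) (λ { (x ∷ xs) → x , xs }) (λ { (x ∷ xs) → refl }) (λ _ → refl)

vec-injection⇒≤ : ∀ {A : Set} {q k n} → 2 ≤ q → Fin q ↔ A →
                  (f : Vec A k → Vec A n) → Injective _≡_ _≡_ f → k ≤ n
vec-injection⇒≤ {q = q} {k} {n} 2≤q Fin↔A f f-injective =
  ≮⇒≥ λ n<k → <⇒≱ (^-monoʳ-< q 2≤q n<k) q^k≤q^n
  where
  q^k≤q^n : q ^ k ≤ q ^ n
  q^k≤q^n = injective⇒≤ (Injection.injective
    (↔⇒↣ (↔-sym (Fin^↔Vec Fin↔A n)) ↣-∘ (mk↣ f-injective ↣-∘ ↔⇒↣ (Fin^↔Vec Fin↔A k))))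

sub-monoʳ-≤ : ∀ s {i j} → i ℤ.≤ j → s ℤ.- j ℤ.≤ s ℤ.- i
sub-monoʳ-≤ s i≤j = +-monoʳ-≤ s (neg-mono-≤ i≤j)

sub-cancelˡ-≤ : ∀ s {i j} → s ℤ.- j ℤ.≤ s ℤ.- i → i ℤ.≤ j
sub-cancelˡ-≤ s {i} {j} le = neg-cancel-≤ (subst₂ ℤ._≤_ (cancel j) (cancel i) (+-monoʳ-≤ (ℤ.- s) le))
  where
  open ℤ-Solver.+-*-Solver
  cancel : ∀ x → ℤ.- s ℤ.+ (s ℤ.- x) ≡ ℤ.- x
  cancel = solve 2 (λ s x → :- s :+ (s :- x) := :- x) refl s

a-b≡u+w-2b : ∀ a b u w → a ℕ.+ b ≡ u ℕ.+ w → + a ℤ.- + b ≡ (+ u ℤ.+ + w) ℤ.- + 2 ℤ.* + b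
a-b≡u+w-2b a b u w a+b≡u+w = begin
  + a ℤ.- + b                     ≡⟨ solve 2 (λ a b → a :- b := (a :+ b) :- con (+ 2) :* b) refl (+ a) (+ b) ⟩
  (+ a ℤ.+ + b) ℤ.- + 2 ℤ.* + b   ≡⟨ cong (λ s → s ℤ.- + 2 ℤ.* + b) (trans (sym (pos-+ a b)) (trans (cong +_ a+b≡u+w) (pos-+ u w))) ⟩
  (+ u ℤ.+ + w) ℤ.- + 2 ℤ.* + b   ∎
  where
  open ≡-Reasoning
  open ℤ-Solver.+-*-Solver

module LinearAlgebra {q : ℕ} (𝔽 : FiniteField q) where

  open FiniteField 𝔽
  open IsCommutativeRing isCommutativeRing
    using ( +-comm; +-assoc; +-identityˡ; +-identityʳ; -‿inverseˡ; -‿inverseʳ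
          ; *-assoc; *-comm; *-identityˡ; distribˡ; distribʳ; zeroˡ; zeroʳ)

  Vector : ℕ → Set
  Vector = Vect 𝔽

  0ᵥ : ∀ {v} → Vector v
  0ᵥ = zeroV 𝔽

  infixl 6 _+ᵥ_
  infixr 7 _·ᵥ_

  _+ᵥ_ : ∀ {v} → Vector v → Vector v → Vector v
  _+ᵥ_ = _⊕_ 𝔽

  _·ᵥ_ : ∀ {v} → Carrier → Vector v → Vector v
  _·ᵥ_ = _⊙_ 𝔽

  -ᵥ_ : ∀ {v} → Vector v → Vector v
  -ᵥ_ = map -_

  lc : ∀ {v k} → Vec Carrier k → Vec (Vector v) k → Vector v
  lc = lincomb 𝔽

  +ᵥ-abelianGroup : ℕ → AbelianGroup 0ℓ 0ℓ
  +ᵥ-abelianGroup v = record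
    { Carrier = Vector v
    ; isAbelianGroup = record
      { isGroup = record
        { isMonoid = record
          { isSemigroup = record { isMagma = isMagma _+ᵥ_ ; assoc = zipWith-assoc +-assoc }
          ; identity = zipWith-identityˡ +-identityˡ , zipWith-identityʳ +-identityʳ
          }
        ; inverse = zipWith-inverseˡ -‿inverseˡ , zipWith-inverseʳ -‿inverseʳ
        ; ⁻¹-cong = cong -ᵥ_
        }
      ; comm = zipWith-comm +-comm
      }
    }

  module +ᵥ {v : ℕ} where
    open AbelianGroup (+ᵥ-abelianGroup v) public using (assoc; identityˡ; identityʳ; inverseʳ)
    open AbelianGroupProperties (+ᵥ-abelianGroup v) public
      using (inverseˡ-unique; inverseʳ-unique; x∙y⁻¹≈ε⇒x≈y)
    open CommutativeSemigroupProperties (AbelianGroup.commutativeSemigroup (+ᵥ-abelianGroup v)) public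
      using (interchange)

  ·ᵥ-distribˡ : ∀ {v} c (x y : Vector v) → c ·ᵥ (x +ᵥ y) ≡ c ·ᵥ x +ᵥ c ·ᵥ y
  ·ᵥ-distribˡ c [] [] = refl
  ·ᵥ-distribˡ c (a ∷ x) (b ∷ y) = cong₂ _∷_ (distribˡ c a b) (·ᵥ-distribˡ c x y)

  ·ᵥ-distribʳ : ∀ {v} c d (x : Vector v) → (c + d) ·ᵥ x ≡ c ·ᵥ x +ᵥ d ·ᵥ x
  ·ᵥ-distribʳ c d [] = refl
  ·ᵥ-distribʳ c d (a ∷ x) = cong₂ _∷_ (distribʳ a c d) (·ᵥ-distribʳ c d x)

  ·ᵥ-assoc : ∀ {v} c d (x : Vector v) → (c * d) ·ᵥ x ≡ c ·ᵥ d ·ᵥ x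
  ·ᵥ-assoc c d x = trans (map-cong (*-assoc c d) x) (map-∘ (c *_) (d *_) x)

  ·ᵥ-identityˡ : ∀ {v} (x : Vector v) → 1# ·ᵥ x ≡ x
  ·ᵥ-identityˡ x = trans (map-cong *-identityˡ x) (map-id x)

  ·ᵥ-zeroˡ : ∀ {v} (x : Vector v) → 0# ·ᵥ x ≡ 0ᵥ
  ·ᵥ-zeroˡ x = trans (map-cong zeroˡ x) (map-const x 0#)

  ·ᵥ-zeroʳ : ∀ {v} c → c ·ᵥ 0ᵥ {v} ≡ 0ᵥ
  ·ᵥ-zeroʳ {v} c = trans (map-replicate (c *_) 0# v) (cong (replicate v) (zeroʳ c))

  replicate-++ : ∀ m n (x : Carrier) → replicate (m ℕ.+ n) x ≡ replicate m x ++ replicate n x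
  replicate-++ zero n x = refl
  replicate-++ (suc m) n x = cong (x ∷_) (replicate-++ m n x)

  lc-zeros : ∀ {v k} (bs : Vec (Vector v) k) → lc 0ᵥ bs ≡ 0ᵥ
  lc-zeros [] = refl
  lc-zeros (b ∷ bs) = trans (cong₂ _+ᵥ_ (·ᵥ-zeroˡ b) (lc-zeros bs)) (+ᵥ.identityˡ 0ᵥ)

  lc-+ : ∀ {v k} (cs ds : Vec Carrier k) (bs : Vec (Vector v) k) →
         lc (cs +ᵥ ds) bs ≡ lc cs bs +ᵥ lc ds bs
  lc-+ [] [] [] = sym (+ᵥ.identityˡ 0ᵥ)
  lc-+ (c ∷ cs) (d ∷ ds) (b ∷ bs) =
    trans (cong₂ _+ᵥ_ (·ᵥ-distribʳ c d b) (lc-+ cs ds bs)) (+ᵥ.interchange _ _ _ _)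

  lc-· : ∀ {v k} c (cs : Vec Carrier k) (bs : Vec (Vector v) k) → lc (c ·ᵥ cs) bs ≡ c ·ᵥ lc cs bs
  lc-· c [] [] = sym (·ᵥ-zeroʳ c)
  lc-· c (d ∷ cs) (b ∷ bs) =
    trans (cong₂ _+ᵥ_ (·ᵥ-assoc c d b) (lc-· c cs bs)) (sym (·ᵥ-distribˡ c _ _))

  lc-neg : ∀ {v k} (cs : Vec Carrier k) (bs : Vec (Vector v) k) → lc (-ᵥ cs) bs ≡ -ᵥ lc cs bs
  lc-neg cs bs = +ᵥ.inverseʳ-unique (lc cs bs) (lc (-ᵥ cs) bs)
    (trans (sym (lc-+ cs (-ᵥ cs) bs)) (trans (cong (λ ds → lc ds bs) (+ᵥ.inverseʳ cs)) (lc-zeros bs)))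

  lc-++ : ∀ {v k n} (cs : Vec Carrier k) (ds : Vec Carrier n) bs (es : Vec (Vector v) n) →
          lc (cs ++ ds) (bs ++ es) ≡ lc cs bs +ᵥ lc ds es
  lc-++ [] ds [] es = sym (+ᵥ.identityˡ _)
  lc-++ (c ∷ cs) ds (b ∷ bs) es = trans (cong (c ·ᵥ b +ᵥ_) (lc-++ cs ds bs es)) (sym (+ᵥ.assoc _ _ _))

  InSpan : ∀ {v k} → Vec (Vector v) k → Pred (Vector v) 0ℓ
  InSpan {k = k} bs x = Σ (Vec Carrier k) λ cs → lc cs bs ≡ x

  span : ∀ {v k} → Vec (Vector v) k → Subspace 𝔽 v
  span bs = record
    { mem = InSpan bs
    ; mem-0 = 0ᵥ , lc-zeros bs
    ; mem-+ = λ { (cs , refl) (ds , refl) → cs +ᵥ ds , lc-+ cs ds bs }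
    ; mem-· = λ { c (cs , refl) → c ·ᵥ cs , lc-· c cs bs }
    }

  span-∷-⊆ : ∀ {v k} (U : Subspace 𝔽 v) {x} {bs : Vec (Vector v) k} →
             mem U x → InSpan bs ⊆ mem U → InSpan (x ∷ bs) ⊆ mem U
  span-∷-⊆ U x∈U bs⊆U (c ∷ cs , refl) = mem-+ U (mem-· U c x∈U) (bs⊆U (cs , refl))

  span-++ˡ : ∀ {v k n} (bs : Vec (Vector v) k) (es : Vec (Vector v) n) → InSpan bs ⊆ InSpan (bs ++ es)
  span-++ˡ bs es (cs , refl) =
    cs ++ 0ᵥ , trans (lc-++ cs 0ᵥ bs es) (trans (cong (lc cs bs +ᵥ_) (lc-zeros es)) (+ᵥ.identityʳ _))

  span-++ʳ : ∀ {v k n} (bs : Vec (Vector v) k) (es : Vec (Vector v) n) → InSpan es ⊆ InSpan (bs ++ es)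
  span-++ʳ bs es (ds , refl) =
    0ᵥ ++ ds , trans (lc-++ 0ᵥ ds bs es) (trans (cong (_+ᵥ lc ds es) (lc-zeros bs)) (+ᵥ.identityˡ _))

  span-++⁻ : ∀ {v k n} (bs : Vec (Vector v) k) (es : Vec (Vector v) n) {x} → InSpan (bs ++ es) x →
             Σ (Vec Carrier k) λ cs → Σ (Vec Carrier n) λ ds → lc cs bs +ᵥ lc ds es ≡ x
  span-++⁻ {k = k} bs es (cds , refl) with splitAt k cds
  ... | cs , ds , refl = cs , ds , sym (lc-++ cs ds bs es)

  any?-Vec : ∀ {k} {P : Pred (Vec Carrier k) 0ℓ} → Decidable P → Dec (∃ P)
  any?-Vec {k} {P} P? =
    map′ (λ (i , p) → to i , p) (λ (cs , p) → from cs , subst P (sym (strictlyInverseˡ cs)) p) (any? (P? ∘ to))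
    where open Inverse (Fin^↔Vec card k) using (to; from; strictlyInverseˡ)

  InSpan? : ∀ {v k} (bs : Vec (Vector v) k) → Decidable (InSpan bs)
  InSpan? bs x = any?-Vec λ cs → ≡-dec _≟_ (lc cs bs) x

  []-independent : ∀ {v} → LinIndep 𝔽 {v} []
  []-independent [] _ = refl

  lc-injective : ∀ {v k} {bs : Vec (Vector v) k} → LinIndep 𝔽 bs →
                 ∀ {cs ds} → lc cs bs ≡ lc ds bs → cs ≡ ds
  lc-injective {bs = bs} indep {cs} {ds} eq = +ᵥ.x∙y⁻¹≈ε⇒x≈y cs ds (indep (cs +ᵥ -ᵥ ds) (begin
    lc (cs +ᵥ -ᵥ ds) bs         ≡⟨ lc-+ cs (-ᵥ ds) bs ⟩
    lc cs bs +ᵥ lc (-ᵥ ds) bs   ≡⟨ cong₂ _+ᵥ_ eq (lc-neg ds bs) ⟩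
    lc ds bs +ᵥ -ᵥ lc ds bs     ≡⟨ +ᵥ.inverseʳ _ ⟩
    0ᵥ                          ∎))
    where open ≡-Reasoning

  ∷-independent : ∀ {v k x} {bs : Vec (Vector v) k} → LinIndep 𝔽 bs → ¬ InSpan bs x → LinIndep 𝔽 (x ∷ bs)
  ∷-independent {x = x} {bs} indep x∉bs (c ∷ cs) eq with c ≟ 0#
  ... | yes refl =
    cong (0# ∷_) (indep cs (trans (sym (+ᵥ.identityˡ _)) (trans (cong (_+ᵥ lc cs bs) (sym (·ᵥ-zeroˡ x))) eq)))
  ... | no c≢0 with inverse c c≢0
  ... | c⁻¹ , cc⁻¹≡1 = ⊥-elim (x∉bs (c⁻¹ ·ᵥ -ᵥ cs , (begin
    lc (c⁻¹ ·ᵥ -ᵥ cs) bs   ≡⟨ trans (lc-· c⁻¹ (-ᵥ cs) bs) (cong (c⁻¹ ·ᵥ_) (lc-neg cs bs)) ⟩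
    c⁻¹ ·ᵥ -ᵥ lc cs bs     ≡⟨ cong (c⁻¹ ·ᵥ_) (sym (+ᵥ.inverseˡ-unique _ _ eq)) ⟩
    c⁻¹ ·ᵥ c ·ᵥ x          ≡⟨ sym (·ᵥ-assoc c⁻¹ c x) ⟩
    (c⁻¹ * c) ·ᵥ x         ≡⟨ cong (_·ᵥ x) (trans (*-comm c⁻¹ c) cc⁻¹≡1) ⟩
    1# ·ᵥ x                ≡⟨ ·ᵥ-identityˡ x ⟩
    x                      ∎)))
    where open ≡-Reasoning

  ++-independent⁻ : ∀ {v k n} {bs : Vec (Vector v) k} {es : Vec (Vector v) n} → LinIndep 𝔽 (bs ++ es) →
                    ∀ cs ds → lc cs bs +ᵥ lc ds es ≡ 0ᵥ → cs ≡ 0ᵥ × ds ≡ 0ᵥ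
  ++-independent⁻ {k = k} {n} {bs} {es} indep cs ds eq =
    ++-injective cs 0ᵥ (trans (indep (cs ++ ds) (trans (lc-++ cs ds bs es) eq)) (replicate-++ k n 0#))

  ++-independent⁺ : ∀ {v k n} {bs : Vec (Vector v) k} {es : Vec (Vector v) n} →
                    (∀ cs ds → lc cs bs +ᵥ lc ds es ≡ 0ᵥ → cs ≡ 0ᵥ × ds ≡ 0ᵥ) → LinIndep 𝔽 (bs ++ es)
  ++-independent⁺ {k = k} {n} {bs} {es} trivial cds eq with splitAt k cds
  ... | cs , ds , refl with trivial cs ds (trans (sym (lc-++ cs ds bs es)) eq)
  ... | refl , refl = sym (replicate-++ k n 0#)

  ++-independentʳ : ∀ {v k n} (bs : Vec (Vector v) k) {es : Vec (Vector v) n} →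
                    LinIndep 𝔽 (bs ++ es) → LinIndep 𝔽 es
  ++-independentʳ bs indep ds eq =
    proj₂ (++-independent⁻ indep 0ᵥ ds (trans (cong₂ _+ᵥ_ (lc-zeros bs) eq) (+ᵥ.identityˡ 0ᵥ)))

  2≤q : 2 ≤ q
  2≤q = injective⇒≤ {f = bit} bit-injective
    where
    from-injective : ∀ {x y} → Inverse.from card x ≡ Inverse.from card y → x ≡ y
    from-injective = Injection.injective (↔⇒↣ (↔-sym card))
    bit : Fin 2 → Fin q
    bit Fin.zero = Inverse.from card 0#
    bit (Fin.suc _) = Inverse.from card 1#
    bit-injective : Injective _≡_ _≡_ bit
    bit-injective {Fin.zero} {Fin.zero} _ = refl
    bit-injective {Fin.zero} {Fin.suc Fin.zero} e = ⊥-elim (0≢1 (from-injective e))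
    bit-injective {Fin.suc Fin.zero} {Fin.zero} e = ⊥-elim (0≢1 (from-injective (sym e)))
    bit-injective {Fin.suc Fin.zero} {Fin.suc Fin.zero} _ = refl

  -- By counting: rewriting combinations of bs as combinations of us is an injective map Fᵏ → Fⁿ.
  steinitz : ∀ {v k n} {bs : Vec (Vector v) k} {us : Vec (Vector v) n} →
             LinIndep 𝔽 bs → InSpan bs ⊆ InSpan us → k ≤ n
  steinitz {k = k} {n} {bs} {us} indep bs⊆us = vec-injection⇒≤ 2≤q card coefficients coefficients-injective
    where
    coefficients : Vec Carrier k → Vec Carrier n
    coefficients cs = proj₁ (bs⊆us (cs , refl))
    coefficients-injective : Injective _≡_ _≡_ coefficients
    coefficients-injective {cs} {ds} eq = lc-injective indep (begin
      lc cs bs                  ≡⟨ sym (proj₂ (bs⊆us (cs , refl))) ⟩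
      lc (coefficients cs) us   ≡⟨ cong (λ es → lc es us) eq ⟩
      lc (coefficients ds) us   ≡⟨ proj₂ (bs⊆us (ds , refl)) ⟩
      lc ds bs                  ∎)
      where open ≡-Reasoning

  IsBasisOf : ∀ {v k} → Pred (Vector v) 0ℓ → Vec (Vector v) k → Set
  IsBasisOf P bs = LinIndep 𝔽 bs × (∀ x → P x ⇔ InSpan bs x)

  dim-mono : ∀ {v a b} {P Q : Pred (Vector v) 0ℓ} → HasDimSet 𝔽 P a → HasDimSet 𝔽 Q b → P ⊆ Q → a ≤ b
  dim-mono (_ , indep , P⇔) (_ , _ , Q⇔) P⊆Q =
    steinitz indep λ {x} → Equivalence.to (Q⇔ x) ∘ P⊆Q ∘ Equivalence.from (P⇔ x)

  dim-unique : ∀ {v a b} {P : Pred (Vector v) 0ℓ} → HasDimSet 𝔽 P a → HasDimSet 𝔽 P b → a ≡ b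
  dim-unique hP hP′ = ≤-antisym (dim-mono hP hP′ id) (dim-mono hP′ hP id)

  HasDimSet-decidable : ∀ {v k} {P : Pred (Vector v) 0ℓ} → HasDimSet 𝔽 P k → Decidable P
  HasDimSet-decidable (bs , _ , P⇔) x = Dec.map (⇔-sym (P⇔ x)) (InSpan? bs x)

  module _ {v d} (U : Subspace 𝔽 v) (U? : Decidable (mem U))
           (us : Vec (Vector v) d) (U⊆us : mem U ⊆ InSpan us) where

    -- Adjoin vectors of U outside the current span; there is room for at most d of them.
    extendToBasis : ∀ {k} {cs : Vec (Vector v) k} → LinIndep 𝔽 cs → InSpan cs ⊆ mem U →
                    Σ ℕ λ t → Σ (Vec (Vector v) t) λ es → IsBasisOf (mem U) (es ++ cs)
    extendToBasis {k} {cs} = grow (suc d) [] (m≤n+m (suc d) k)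
      where
      grow : ∀ fuel {t} (es : Vec (Vector v) t) → d < t ℕ.+ k ℕ.+ fuel →
             LinIndep 𝔽 (es ++ cs) → InSpan (es ++ cs) ⊆ mem U →
             Σ ℕ λ t → Σ (Vec (Vector v) t) λ es → IsBasisOf (mem U) (es ++ cs)
      grow zero {t} es room indep ⊆U =
        ⊥-elim (<⇒≱ (subst (d <_) (ℕ.+-identityʳ (t ℕ.+ k)) room) (steinitz indep (U⊆us ∘ ⊆U)))
      grow (suc fuel) {t} es room indep ⊆U
        with any?-Vec (λ x → U? x ×-dec ¬? (InSpan? (es ++ cs) x))
      ... | yes (x , x∈U , x∉span) =
        grow fuel (x ∷ es) (subst (d <_) (ℕ.+-suc (t ℕ.+ k) fuel) room) (∷-independent indep x∉span) (span-∷-⊆ U x∈U ⊆U)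
      ... | no ∄ = t , es , indep , λ x → mk⇔
        (λ x∈U → decidable-stable (InSpan? (es ++ cs) x) λ x∉span → ∄ (x , x∈U , x∉span)) ⊆U

  extendToBasisOf : ∀ {v u k} (U : Subspace 𝔽 v) {cs : Vec (Vector v) k} → HasDim 𝔽 U u →
                    LinIndep 𝔽 cs → InSpan cs ⊆ mem U →
                    Σ ℕ λ t → Σ (Vec (Vector v) t) λ es → IsBasisOf (mem U) (es ++ cs)
  extendToBasisOf U hU@(bs , _ , U⇔) =
    extendToBasis U (HasDimSet-decidable hU) bs λ {x} → Equivalence.to (U⇔ x)

  span-hasDim : ∀ {v k} {bs : Vec (Vector v) k} → LinIndep 𝔽 bs → HasDim 𝔽 (span bs) k
  span-hasDim {bs = bs} indep = bs , indep , λ _ → mk⇔ id id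

  subfamily : ∀ {v d k} (bs : Vec (Vector v) d) → k ≤ d → LinIndep 𝔽 bs →
              Σ (Vec (Vector v) k) λ ts → LinIndep 𝔽 ts × InSpan ts ⊆ InSpan bs
  subfamily bs k≤d indep with m≤n⇒m<n∨m≡n k≤d
  ... | inj₂ refl = bs , indep , id
  subfamily (b ∷ bs) _ indep | inj₁ k<d with subfamily bs (s≤s⁻¹ k<d) (++-independentʳ (b ∷ []) indep)
  ... | ts , ts-independent , ts⊆bs = ts , ts-independent , span-++ʳ (b ∷ []) bs ∘ ts⊆bs

  subspaceOfDim : ∀ {v d k} (U : Subspace 𝔽 v) → HasDim 𝔽 U d → k ≤ d →
                  Σ (Subspace 𝔽 v) λ T → HasDim 𝔽 T k × mem T ⊆ mem U
  subspaceOfDim U (bs , indep , U⇔) k≤d with subfamily bs k≤d indep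
  ... | ts , ts-independent , ts⊆bs =
    span ts , span-hasDim ts-independent , λ {x} → Equivalence.from (U⇔ x) ∘ ts⊆bs

  _∩ˢ_ : ∀ {v} → Subspace 𝔽 v → Subspace 𝔽 v → Subspace 𝔽 v
  U ∩ˢ W = record
    { mem = capSet 𝔽 U W
    ; mem-0 = mem-0 U , mem-0 W
    ; mem-+ = λ (x∈U , x∈W) (y∈U , y∈W) → mem-+ U x∈U y∈U , mem-+ W x∈W y∈W
    ; mem-· = λ c (x∈U , x∈W) → mem-· U c x∈U , mem-· W c x∈W
    }

  capDim-exists : ∀ {v u w} (U W : Subspace 𝔽 v) → HasDim 𝔽 U u → HasDim 𝔽 W w →
                  Σ ℕ (HasDimSet 𝔽 (capSet 𝔽 U W))
  capDim-exists U W hU@(bs , _ , U⇔) hW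
    with extendToBasis (U ∩ˢ W) (λ x → HasDimSet-decidable hU x ×-dec HasDimSet-decidable hW x)
                       bs (λ {x} → Equivalence.to (U⇔ x) ∘ proj₁) []-independent
                       (λ { ([] , refl) → mem-0 (U ∩ˢ W) })
  ... | t , es , basis = t ℕ.+ 0 , es ++ [] , basis

  capDim-of-≐ : ∀ {v k} (U W : Subspace 𝔽 v) → _≐_ 𝔽 U W → HasDim 𝔽 U k → HasDimSet 𝔽 (capSet 𝔽 U W) k
  capDim-of-≐ U W U≐W (bs , indep , U⇔) = bs , indep , λ x → mk⇔
    (Equivalence.to (U⇔ x) ∘ proj₁)
    (λ x∈bs → let x∈U = Equivalence.from (U⇔ x) x∈bs in x∈U , Equivalence.to (U≐W x) x∈U)

  -- The Grassmann formula and the subspace distance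

  sum-basis : ∀ {v k te tf} {U W : Subspace 𝔽 v}
              {cs : Vec (Vector v) k} {es : Vec (Vector v) te} {fs : Vec (Vector v) tf} →
              IsBasisOf (capSet 𝔽 U W) cs → IsBasisOf (mem U) (es ++ cs) → IsBasisOf (mem W) (fs ++ cs) →
              IsBasisOf (sumSet 𝔽 U W) (es ++ (fs ++ cs))
  sum-basis {k = k} {tf = tf} {U = U} {W} {cs} {es} {fs} (_ , C⇔) (indU , U⇔) (indW , W⇔) =
    ++-independent⁺ independent , λ x → mk⇔ (spans x) (spanned x)
    where
    open ≡-Reasoning
    inU : ∀ {x} → InSpan (es ++ cs) x → mem U x
    inU {x} = Equivalence.from (U⇔ x)
    inW : ∀ {x} → InSpan (fs ++ cs) x → mem W x
    inW {x} = Equivalence.from (W⇔ x)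

    spans : ∀ x → sumSet 𝔽 U W x → InSpan (es ++ (fs ++ cs)) x
    spans _ (u , w , u∈U , w∈W , refl) with span-++⁻ es cs (Equivalence.to (U⇔ u) u∈U)
    ... | α , γ , αγ≡u with Equivalence.to (W⇔ _) (mem-+ W (proj₂ (Equivalence.from (C⇔ _) (γ , refl))) w∈W)
    ... | ρ , ρ≡γw = α ++ ρ , (begin
      lc (α ++ ρ) (es ++ (fs ++ cs))     ≡⟨ lc-++ α ρ es (fs ++ cs) ⟩
      lc α es +ᵥ lc ρ (fs ++ cs)         ≡⟨ cong (lc α es +ᵥ_) ρ≡γw ⟩
      lc α es +ᵥ (lc γ cs +ᵥ w)          ≡⟨ sym (+ᵥ.assoc _ _ w) ⟩
      lc α es +ᵥ lc γ cs +ᵥ w            ≡⟨ cong (_+ᵥ w) αγ≡u ⟩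
      u +ᵥ w                             ∎)

    spanned : ∀ x → InSpan (es ++ (fs ++ cs)) x → sumSet 𝔽 U W x
    spanned x x∈span with span-++⁻ es (fs ++ cs) x∈span
    ... | α , ρ , eq = lc α es , lc ρ (fs ++ cs) , inU (span-++ˡ es cs (α , refl)) , inW (ρ , refl) , eq

    -- From lc α es + R = 0 with R = lc ρ (fs ++ cs) we get R ∈ U ∩ W = span cs,
    -- so ρ vanishes on fs.
    independent : ∀ α ρ → lc α es +ᵥ lc ρ (fs ++ cs) ≡ 0ᵥ → α ≡ 0ᵥ × ρ ≡ 0ᵥ
    independent α ρ eq with Equivalence.to (C⇔ _) (R∈U , inW (ρ , refl))
      where
      R∈U : mem U (lc ρ (fs ++ cs))
      R∈U = inU (span-++ˡ es cs (-ᵥ α , trans (lc-neg α es) (sym (+ᵥ.inverseʳ-unique _ _ eq))))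
    ... | δ , δ≡R with lc-injective indW {0ᵥ {tf} ++ δ} {ρ} (trans (proj₂ (span-++ʳ fs cs (δ , refl))) δ≡R)
    ... | refl with ++-independent⁻ indU α δ (trans (cong (lc α es +ᵥ_) δ≡R) eq)
    ... | refl , refl = refl , sym (replicate-++ tf k 0#)

  module _ {v u w} (U W : Subspace 𝔽 v) (hU : HasDim 𝔽 U u) (hW : HasDim 𝔽 W w) where

    sumDim-from-capBasis : ∀ {b} {cs : Vec (Vector v) b} → IsBasisOf (capSet 𝔽 U W) cs →
                           Σ ℕ λ a → HasDimSet 𝔽 (sumSet 𝔽 U W) a × a ℕ.+ b ≡ u ℕ.+ w
    sumDim-from-capBasis {b} {cs} cs-basis@(indC , C⇔)
      with extendToBasisOf U hU indC (proj₁ ∘ Equivalence.from (C⇔ _))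
         | extendToBasisOf W hW indC (proj₂ ∘ Equivalence.from (C⇔ _))
    ... | te , es , es-basis | tf , fs , fs-basis =
      te ℕ.+ (tf ℕ.+ b) , (es ++ (fs ++ cs) , sum-basis {U = U} {W} cs-basis es-basis fs-basis) , (begin
        te ℕ.+ (tf ℕ.+ b) ℕ.+ b     ≡⟨ solve 3 (λ te tf b → te :+ (tf :+ b) :+ b := (te :+ b) :+ (tf :+ b)) refl te tf b ⟩
        (te ℕ.+ b) ℕ.+ (tf ℕ.+ b)   ≡⟨ cong₂ ℕ._+_ (dim-unique (es ++ cs , es-basis) hU) (dim-unique (fs ++ cs , fs-basis) hW) ⟩
        u ℕ.+ w                     ∎)
      where
      open ≡-Reasoning
      open +-*-Solver

    grassmann : ∀ {a b} → HasDimSet 𝔽 (sumSet 𝔽 U W) a → HasDimSet 𝔽 (capSet 𝔽 U W) b → a ℕ.+ b ≡ u ℕ.+ w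
    grassmann {b = b} hS (_ , cs-basis) =
      let _ , hS′ , a′+b≡u+w = sumDim-from-capBasis cs-basis
      in trans (cong (ℕ._+ b) (dim-unique hS hS′)) a′+b≡u+w

    sumDim-exists : Σ ℕ (HasDimSet 𝔽 (sumSet 𝔽 U W))
    sumDim-exists = let _ , _ , cs-basis = capDim-exists U W hU hW
                    in Σ.map₂ proj₁ (sumDim-from-capBasis cs-basis)

    DistGE⇒capDim-bound : ∀ {l b} → DistGE 𝔽 U W (+ u ℤ.+ + w ℤ.- l) → HasDimSet 𝔽 (capSet 𝔽 U W) b →
                   + 2 ℤ.* + b ℤ.≤ l
    DistGE⇒capDim-bound {l} {b} dist hC =
      let a , hS = sumDim-exists
      in sub-cancelˡ-≤ (+ u ℤ.+ + w) (subst (_ ℤ.≤_) (a-b≡u+w-2b a b u w (grassmann hS hC)) (dist a b hS hC))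

    capDim-bound⇒DistGE : ∀ {l} → (∀ {b} → HasDimSet 𝔽 (capSet 𝔽 U W) b → + 2 ℤ.* + b ℤ.≤ l) →
                         DistGE 𝔽 U W (+ u ℤ.+ + w ℤ.- l)
    capDim-bound⇒DistGE bound a b hS hC =
      subst (_ ℤ.≤_) (sym (a-b≡u+w-2b a b u w (grassmann hS hC))) (sub-monoʳ-≤ (+ u ℤ.+ + w) (bound hC))

    DistGE⇒capDim-bound-⊆ : ∀ {l b} (T T′ : Subspace 𝔽 v) → mem T ⊆ mem U → mem T′ ⊆ mem W →
                            DistGE 𝔽 U W (+ u ℤ.+ + w ℤ.- l) → HasDimSet 𝔽 (capSet 𝔽 T T′) b →
                            + 2 ℤ.* + b ℤ.≤ l
    DistGE⇒capDim-bound-⊆ T T′ T⊆U T′⊆W dist hC =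
      let B , hB = capDim-exists U W hU hW
      in ℤ.≤-trans (*-monoˡ-≤-nonNeg (+ 2) (ℤ.+≤+ (dim-mono hC hB (Σ.map T⊆U T′⊆W))))
                   (DistGE⇒capDim-bound dist hB)

lemma8 : ∀ {q} (𝔽 : FiniteField q) (v : ℕ) (l : ℤ) (m M : ℕ) →
    l ℤ.< (+ 2) ℤ.* (+ m) →
    (N : ℕ) (S : Fin N → Subspace 𝔽 v) (dim : Fin N → ℕ) →
    (∀ j → HasDim 𝔽 (S j) (dim j) × (m ≤ dim j × dim j ≤ M)) →
    (∀ j j' → ¬ (j ≡ j') → ¬ (_≐_ 𝔽 (S j) (S j'))) →
    (∀ j j' → ¬ (j ≡ j') → DistGE 𝔽 (S j) (S j') ((+ dim j) ℤ.+ (+ dim j') ℤ.- l)) →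
    (a : ℕ) → IsAq 𝔽 v ((+ 2) ℤ.* (+ m) ℤ.- l) m a → N ≤ a
lemma8 𝔽 v l m M l<2m N S dim S-dims _ S-dist a (_ , maximal) = maximal N T (T-dim , T-distinct , T-dist)
  where
  open LinearAlgebra 𝔽
  hS : ∀ j → HasDim 𝔽 (S j) (dim j)
  hS j = proj₁ (S-dims j)
  truncation : ∀ j → Σ (Subspace 𝔽 v) λ T → HasDim 𝔽 T m × mem T ⊆ mem (S j)
  truncation j = subspaceOfDim (S j) (hS j) (proj₁ (proj₂ (S-dims j)))
  T : Fin N → Subspace 𝔽 v
  T j = proj₁ (truncation j)
  T-dim : ∀ j → HasDim 𝔽 (T j) m
  T-dim j = proj₁ (proj₂ (truncation j))
  T⊆S : ∀ j → mem (T j) ⊆ mem (S j)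
  T⊆S j = proj₂ (proj₂ (truncation j))
  T-capDim-bound : ∀ j j′ → ¬ (j ≡ j′) → ∀ {b} → HasDimSet 𝔽 (capSet 𝔽 (T j) (T j′)) b → + 2 ℤ.* + b ℤ.≤ l
  T-capDim-bound j j′ j≢j′ =
    DistGE⇒capDim-bound-⊆ (S j) (S j′) (hS j) (hS j′) (T j) (T j′) (T⊆S j) (T⊆S j′) (S-dist j j′ j≢j′)
  T-dist : ∀ j j′ → ¬ (j ≡ j′) → DistGE 𝔽 (T j) (T j′) ((+ 2) ℤ.* (+ m) ℤ.- l)
  T-dist j j′ j≢j′ = subst (λ d → DistGE 𝔽 (T j) (T j′) (d ℤ.- l)) (m+m≡2m m)
    (capDim-bound⇒DistGE (T j) (T j′) (T-dim j) (T-dim j′) (T-capDim-bound j j′ j≢j′))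
    where
    open ℤ-Solver.+-*-Solver
    m+m≡2m : ∀ m → + m ℤ.+ + m ≡ + 2 ℤ.* + m
    m+m≡2m m = solve 1 (λ m → m :+ m := con (+ 2) :* m) refl (+ m)
  -- The S_j need not be pairwise distinct: the T_j are, because l < 2m.
  T-distinct : ∀ j j′ → ¬ (j ≡ j′) → ¬ (_≐_ 𝔽 (T j) (T j′))
  T-distinct j j′ j≢j′ T≐T′ = ℤ.<⇒≱ l<2m (T-capDim-bound j j′ j≢j′ (capDim-of-≐ (T j) (T j′) T≐T′ (T-dim j)))
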